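{- Let $k$ and $c$ be positive integers, and let $H_1,H_2$ be graphs each of which has a $c$-colouring with clustering at most $k$. Then $H_1\boxtimes H_2$ has a $c$-colouring with clustering at most $k\,|V(H_1\boxtimes H_2)|^{1/2}$.
   Context: All graphs are finite and simple. A colouring of a graph assigns a colour to each vertex (adjacent vertices may receive the same colour); a $c$-colouring uses at most $c$ colours. A monochromatic component is a connected component of the subgraph induced by the vertices of one colour. A colouring has clustering at most $k$ if every monochromatic component has at most $k$ vertices. The strong product $G\boxtimes H$ has vertex set $V(G)\times V(H)$, with distinct $(u,v),(u',v')$ adjacent iff ($u=u'$ and $vv'\in E(H)$) or ($v=v'$ and $uu'\in E(G)$) or ($uu'\in E(G)$ and $vv'\in E(H)$). -}

module Defs where

open import Data.Nat using (ℕ; _*_; _≤_; _^_)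
open import Data.Fin using (Fin)
open import Data.Fin.Properties using (*↔×)
open import Data.Product using (_×_; _,_)
open import Data.Sum using (_⊎_; inj₁; inj₂)
open import Data.Empty using (⊥)
open import Data.List using (List; length)
open import Data.List.Relation.Unary.All using (All)
open import Data.List.Relation.Unary.Unique.Propositional using (Unique)
open import Function.Bundles using (_↔_)
open import Function.Properties.Inverse using (↔-trans; ↔-sym)
open import Data.Product.Function.NonDependent.Propositional using (_×-↔_)
open import Relation.Binary.PropositionalEquality using (_≡_; refl; sym)

record Graph : Set₁ where
  field
    V     : Set
    size  : ℕ
    enum  : V ↔ Fin size
    Adj   : V → V → Set
    symm  : ∀ {u v} → Adj u v → Adj v u
    irrefl : ∀ {v} → Adj v v → ⊥
open Graph public

∣V∣ : Graph → ℕ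
∣V∣ G = size G

Colouring : Graph → ℕ → Set
Colouring G c = V G → Fin c

data MonoConn (G : Graph) {c : ℕ} (f : Colouring G c) : V G → V G → Set where
  here : ∀ {u} → MonoConn G f u u
  step : ∀ {u x w} → Adj G u x → f u ≡ f x → MonoConn G f x w → MonoConn G f u w

-- Clustering at most k: every monochromatic component has at most k vertices,
-- i.e. every duplicate-free list of vertices of the component of v has length ≤ k.
ClusteringAtMost : (G : Graph) {c : ℕ} → Colouring G c → ℕ → Set
ClusteringAtMost G f k =
  ∀ (v : V G) (xs : List (V G)) → Unique xs → All (MonoConn G f v) xs → length xs ≤ k

StrongAdj : (G H : Graph) → (V G × V H) → (V G × V H) → Set
StrongAdj G H (u , v) (u' , v') =
  (u ≡ u' × Adj H v v') ⊎ ((v ≡ v' × Adj G u u') ⊎ (Adj G u u' × Adj H v v'))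

private
  strongSym : (G H : Graph) → ∀ {p q} → StrongAdj G H p q → StrongAdj G H q p
  strongSym G H (inj₁ (e , a)) = inj₁ (sym e , symm H a)
  strongSym G H (inj₂ (inj₁ (e , a))) = inj₂ (inj₁ (sym e , symm G a))
  strongSym G H (inj₂ (inj₂ (a , b))) = inj₂ (inj₂ (symm G a , symm H b))

  strongIrr : (G H : Graph) → ∀ {p} → StrongAdj G H p p → ⊥
  strongIrr G H (inj₁ (_ , a)) = irrefl H a
  strongIrr G H (inj₂ (inj₁ (_ , a))) = irrefl G a
  strongIrr G H (inj₂ (inj₂ (a , _))) = irrefl G a

_⊠_ : Graph → Graph → Graph
G ⊠ H = record
  { V = V G × V H
  ; size = size G * size H
  ; enum = ↔-trans (enum G ×-↔ enum H) (↔-sym *↔×)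
  ; Adj = StrongAdj G H
  ; symm = strongSym G H
  ; irrefl = strongIrr G H
  }

-- Clustering at most k·√N (a real bound), expressed exactly over ℕ:
-- for a natural number s, s ≤ k·√N  iff  s·s ≤ k·k·N.
ClusteringAtMostTimesSqrt : (G : Graph) {c : ℕ} → Colouring G c → ℕ → ℕ → Set
ClusteringAtMostTimesSqrt G f k N =
  ∀ (v : V G) (xs : List (V G)) → Unique xs → All (MonoConn G f v) xs
    → length xs * length xs ≤ k * k * N

-- Colour H₁ ⊠ H₂ by the colouring of the factor with more vertices, read
-- off the corresponding coordinate. A monochromatic walk in the product
-- projects to a monochromatic walk in that factor, so a monochromatic
-- component meets at most k values of this coordinate, and at most ∣V(H₁)∣·k
-- vertices when H₂ is the larger factor. With ∣V(H₁)∣ ≤ ∣V(H₂)∣ this is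
-- at most k·√(∣V(H₁)∣·∣V(H₂)∣).
module Submission where

open import Defs
open import Data.Nat using (ℕ; NonZero; suc; _+_; _*_; _≤_; z≤n)
open import Data.Nat.Properties using (+-suc; +-mono-≤; *-mono-≤; *-monoʳ-≤; *-comm; ≤-total; ≤-trans; ≤-reflexive; module ≤-Reasoning)
open import Data.Nat.Tactic.RingSolver using (solve-∀)
open import Data.Product using (Σ; _×_; _,_; proj₁; proj₂)
open import Data.Sum using (_⊎_; inj₁; inj₂)
open import Data.Fin using (Fin)
import Data.Fin.Properties as Fin
open import Data.List using (List; []; _∷_; length; map; filter; allFin)
open import Data.List.Properties using (length-map; length-tabulate)
open import Data.List.Relation.Unary.All as All using (All; []; _∷_)
open import Data.List.Relation.Unary.All.Properties using (map⁺; filter⁺; all-filter)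
open import Data.List.Relation.Unary.Any as Any using ()
open import Data.List.Relation.Unary.AllPairs using ([]; _∷_)
open import Data.List.Relation.Unary.Unique.Propositional using (Unique)
import Data.List.Relation.Unary.Unique.Propositional.Properties as Unique
open import Data.List.Membership.Propositional using (_∈_)
open import Data.List.Membership.Propositional.Properties using (∈-allFin)
open import Relation.Binary.PropositionalEquality
open import Relation.Binary.Definitions using (DecidableEquality)
open import Relation.Nullary using (yes; no; ¬?)
open import Relation.Unary using (Decidable)
open import Function using (_∘_)
open import Function.Bundles using (Inverse; Injection)
open import Function.Properties.Inverse using (↔⇒↣)

length-filter+length-filter-¬ : {A : Set} {P : A → Set} (P? : Decidable P) (xs : List A) →
  length xs ≡ length (filter P? xs) + length (filter (¬? ∘ P?) xs)
length-filter+length-filter-¬ P? [] = refl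
length-filter+length-filter-¬ P? (x ∷ xs) with P? x
... | yes _ = cong suc (length-filter+length-filter-¬ P? xs)
... | no _ = trans (cong suc (length-filter+length-filter-¬ P? xs)) (sym (+-suc _ _))

-- Since π and ρ jointly determine z, ρ is injective on each fibre of π, so every
-- value of π is taken by at most k elements of a duplicate-free list.
module FibreCount {Z X Y : Set} (_≟_ : DecidableEquality X) (π : Z → X) (ρ : Z → Y)
  (π-ρ-injective : ∀ {z w} → π z ≡ π w → ρ z ≡ ρ w → z ≡ w)
  {Q : Y → Set} {k : ℕ} (Q-bounded : ∀ ys → Unique ys → All Q ys → length ys ≤ k) where

  unique-map-ρ-fibre : ∀ {a} xs → Unique xs → All (λ z → π z ≡ a) xs → Unique (map ρ xs)
  unique-map-ρ-fibre [] [] [] = []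
  unique-map-ρ-fibre {a} (z ∷ zs) (z∉zs ∷ uniq) (πz≡a ∷ πzs≡a) =
    map⁺ (All.zipWith distinct (z∉zs , πzs≡a)) ∷ unique-map-ρ-fibre zs uniq πzs≡a
    where
    distinct : ∀ {w} → z ≢ w × π w ≡ a → ρ z ≢ ρ w
    distinct (z≢w , πw≡a) ρz≡ρw = z≢w (π-ρ-injective (trans πz≡a (sym πw≡a)) ρz≡ρw)

  length-fibre-≤ : ∀ {a} xs → Unique xs → All (λ z → π z ≡ a) xs → All (Q ∘ ρ) xs →
    length xs ≤ k
  length-fibre-≤ xs uniq πxs≡a Qxs = subst (_≤ k) (length-map ρ xs)
    (Q-bounded (map ρ xs) (unique-map-ρ-fibre xs uniq πxs≡a) (map⁺ Qxs))

  length-≤-length*k : ∀ L xs → Unique xs → All (λ z → π z ∈ L) xs → All (Q ∘ ρ) xs →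
    length xs ≤ length L * k
  length-≤-length*k [] [] _ _ _ = z≤n
  length-≤-length*k [] (_ ∷ _) _ (() ∷ _) _
  length-≤-length*k (a ∷ L) xs uniq πxs∈aL Qxs = begin
      length xs                       ≡⟨ length-filter+length-filter-¬ P? xs ⟩
      length inFibre + length outside ≤⟨ +-mono-≤ inFibre-≤ outside-≤ ⟩
      k + length L * k                ∎
    where
    open ≤-Reasoning
    P? : Decidable (λ z → π z ≡ a)
    P? z = π z ≟ a

    inFibre outside : List Z
    inFibre = filter P? xs
    outside = filter (¬? ∘ P?) xs

    inFibre-≤ : length inFibre ≤ k
    inFibre-≤ = length-fibre-≤ inFibre (Unique.filter⁺ P? uniq) (all-filter P? xs)
      (filter⁺ P? Qxs)

    πoutside∈L : All (λ z → π z ∈ L) outside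
    πoutside∈L = All.zipWith (λ (πz∈aL , πz≢a) → Any.tail πz≢a πz∈aL)
      (filter⁺ (¬? ∘ P?) πxs∈aL , all-filter (¬? ∘ P?) xs)

    outside-≤ : length outside ≤ length L * k
    outside-≤ = length-≤-length*k L outside (Unique.filter⁺ (¬? ∘ P?) uniq) πoutside∈L
      (filter⁺ (¬? ∘ P?) Qxs)

IsWeakHomomorphism : (G H : Graph) → (V G → V H) → Set
IsWeakHomomorphism G H φ = ∀ {u v} → Adj G u v → φ u ≡ φ v ⊎ Adj H (φ u) (φ v)

MonoConn-map : (G H : Graph) {c : ℕ} (f : Colouring H c) (φ : V G → V H) →
  IsWeakHomomorphism G H φ → ∀ {u v} → MonoConn G (f ∘ φ) u v → MonoConn H f (φ u) (φ v)
MonoConn-map G H f φ φ-adj here = here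
MonoConn-map G H f φ φ-adj (step {u} {x} {w} u~x fu≡fx x⇝w) with φ-adj u~x
... | inj₁ φu≡φx = subst (λ y → MonoConn H f y (φ w)) (sym φu≡φx)
                     (MonoConn-map G H f φ φ-adj x⇝w)
... | inj₂ φu~φx = step φu~φx fu≡fx (MonoConn-map G H f φ φ-adj x⇝w)

clustering-pullback : (G H : Graph) {c : ℕ} (f : Colouring H c) {k : ℕ} (φ : V G → V H) →
  IsWeakHomomorphism G H φ → {n : ℕ} (ψ : V G → Fin n) → (∀ {u v} → ψ u ≡ ψ v → φ u ≡ φ v → u ≡ v) →
  ClusteringAtMost H f k → ClusteringAtMost G (f ∘ φ) (n * k)
clustering-pullback G H f φ φ-adj {n} ψ ψ-φ-injective clustered v xs uniq v⇝xs =
  subst (λ m → length xs ≤ m * _) (length-tabulate {n = n} (λ i → i))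
    (FibreCount.length-≤-length*k Fin._≟_ ψ φ ψ-φ-injective (clustered (φ v))
      (allFin n) xs uniq (All.tabulate (λ {u} _ → ∈-allFin (ψ u)))
      (All.map (MonoConn-map G H f φ φ-adj) v⇝xs))

module _ (H₁ H₂ : Graph) where
  proj₁-weakHom : IsWeakHomomorphism (H₁ ⊠ H₂) H₁ proj₁
  proj₁-weakHom (inj₁ (p₁≡q₁ , _)) = inj₁ p₁≡q₁
  proj₁-weakHom (inj₂ (inj₁ (_ , p₁~q₁))) = inj₂ p₁~q₁
  proj₁-weakHom (inj₂ (inj₂ (p₁~q₁ , _))) = inj₂ p₁~q₁

  proj₂-weakHom : IsWeakHomomorphism (H₁ ⊠ H₂) H₂ proj₂
  proj₂-weakHom (inj₁ (_ , p₂~q₂)) = inj₂ p₂~q₂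
  proj₂-weakHom (inj₂ (inj₁ (p₂≡q₂ , _))) = inj₁ p₂≡q₂
  proj₂-weakHom (inj₂ (inj₂ (_ , p₂~q₂))) = inj₂ p₂~q₂

  ⊠-clustering-proj₁ : {c k : ℕ} {f : Colouring H₁ c} → ClusteringAtMost H₁ f k →
    ClusteringAtMost (H₁ ⊠ H₂) (f ∘ proj₁) (∣V∣ H₂ * k)
  ⊠-clustering-proj₁ {f = f} = clustering-pullback (H₁ ⊠ H₂) H₁ f proj₁ proj₁-weakHom
    (Inverse.to (enum H₂) ∘ proj₂) (λ ψ≡ φ≡ → cong₂ _,_ φ≡ (Injection.injective (↔⇒↣ (enum H₂)) ψ≡))

  ⊠-clustering-proj₂ : {c k : ℕ} {f : Colouring H₂ c} → ClusteringAtMost H₂ f k →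
    ClusteringAtMost (H₁ ⊠ H₂) (f ∘ proj₂) (∣V∣ H₁ * k)
  ⊠-clustering-proj₂ {f = f} = clustering-pullback (H₁ ⊠ H₂) H₂ f proj₂ proj₂-weakHom
    (Inverse.to (enum H₁) ∘ proj₁) (λ ψ≡ φ≡ → cong₂ _,_ (Injection.injective (↔⇒↣ (enum H₁)) ψ≡) φ≡)

ClusteringAtMost⇒TimesSqrt : (G : Graph) {c : ℕ} {f : Colouring G c} {s : ℕ} (k N : ℕ) →
  s * s ≤ k * k * N → ClusteringAtMost G f s → ClusteringAtMostTimesSqrt G f k N
ClusteringAtMost⇒TimesSqrt G {s = s} k N s²≤k²N clustered v xs uniq v⇝xs = begin
    length xs * length xs ≤⟨ *-mono-≤ ∣xs∣≤s ∣xs∣≤s ⟩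
    s * s                 ≤⟨ s²≤k²N ⟩
    k * k * N             ∎
  where
  open ≤-Reasoning
  ∣xs∣≤s : length xs ≤ s
  ∣xs∣≤s = clustered v xs uniq v⇝xs

square-≤-*-larger : ∀ {n m} k → n ≤ m → n * k * (n * k) ≤ k * k * (n * m)
square-≤-*-larger {n} {m} k n≤m = begin
    n * k * (n * k) ≡⟨ rearrange n k ⟩
    k * k * (n * n) ≤⟨ *-monoʳ-≤ (k * k) (*-monoʳ-≤ n n≤m) ⟩
    k * k * (n * m) ∎
  where
  open ≤-Reasoning
  rearrange : ∀ n k → n * k * (n * k) ≡ k * k * (n * n)
  rearrange = solve-∀

proposition33 : (k c : ℕ) → .{{NonZero k}} → .{{NonZero c}} → (H₁ H₂ : Graph)
    → Σ (Colouring H₁ c) (λ f → ClusteringAtMost H₁ f k)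
    → Σ (Colouring H₂ c) (λ f → ClusteringAtMost H₂ f k)
    → Σ (Colouring (H₁ ⊠ H₂) c)
        (λ f → ClusteringAtMostTimesSqrt (H₁ ⊠ H₂) f k (∣V∣ (H₁ ⊠ H₂)))
proposition33 k c H₁ H₂ (f₁ , clustered₁) (f₂ , clustered₂) with ≤-total (∣V∣ H₁) (∣V∣ H₂)
... | inj₁ n₁≤n₂ = f₂ ∘ proj₂ ,
  ClusteringAtMost⇒TimesSqrt (H₁ ⊠ H₂) k _ (square-≤-*-larger k n₁≤n₂)
    (⊠-clustering-proj₂ H₁ H₂ clustered₂)
... | inj₂ n₂≤n₁ = f₁ ∘ proj₁ ,
  ClusteringAtMost⇒TimesSqrt (H₁ ⊠ H₂) k _
    (≤-trans (square-≤-*-larger k n₂≤n₁)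
              (≤-reflexive (cong (k * k *_) (*-comm (∣V∣ H₂) (∣V∣ H₁)))))
    (⊠-clustering-proj₁ H₁ H₂ clustered₁)
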